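{- Let $G$ be a clique-chordal graph. Then every block of $G$ is locally connected.
   Context: All graphs are finite, undirected, connected, without loops or multiple edges. The clique graph $K(G)$ has as vertices the maximal cliques of $G$, two being adjacent iff they share a vertex. A graph is chordal if it contains no induced chordless cycle of length at least four. A graph is clique-chordal if its clique graph is chordal. A block is a maximal biconnected subgraph (maximal connected subgraph without an articulation point), viewed as an induced subgraph. A graph is locally connected if for every vertex $v$ the subgraph induced by its open neighbourhood $N(v)$ is connected. -}

module Defs where

open import Data.Nat using (ℕ; suc; _≤_)
open import Data.Fin using (Fin; toℕ)
open import Data.Fin.Subset using (Subset; _∈_; _⊆_; ⊤; _∩_; ⁅_⁆; _-_)
open import Data.Vec using (tabulate)
open import Data.Bool using (Bool; true; false)
open import Data.Product using (Σ; ∃; _×_; _,_)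
open import Data.Sum using (_⊎_)
open import Relation.Binary.PropositionalEquality using (_≡_; _≢_)
open import Relation.Nullary using (¬_)
open import Function.Definitions using (Injective)

record Graph : Set where
  field
    n     : ℕ
    adj   : Fin n → Fin n → Bool
    sym   : ∀ u v → adj u v ≡ adj v u
    irref : ∀ v → adj v v ≡ false

module _ (G : Graph) where
  open Graph G

  Adj : Fin n → Fin n → Set
  Adj u v = adj u v ≡ true

  data WalkIn (S : Subset n) : Fin n → Fin n → Set where
    stay : ∀ {u} → u ∈ S → WalkIn S u u
    step : ∀ {u w v} → u ∈ S → Adj u w → WalkIn S w v → WalkIn S u v

  -- the subgraph induced by S is connected
  -- (the empty vertex set counts as connected, vacuously)
  ConnectedIn : Subset n → Set
  ConnectedIn S = ∀ u v → u ∈ S → v ∈ S → WalkIn S u v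

  Connected : Set
  Connected = ∀ u v → WalkIn ⊤ u v

  remove : Subset n → Fin n → Subset n
  remove S x = S - x

  Biconnected : Subset n → Set
  Biconnected S = ConnectedIn S × (∀ x → x ∈ S → ConnectedIn (remove S x))

  IsBlock : Subset n → Set
  IsBlock S = Biconnected S × (∀ T → S ⊆ T → Biconnected T → T ⊆ S)

  NbhdIn : Subset n → Fin n → Subset n
  NbhdIn S v = S ∩ tabulate (adj v)

  LocallyConnectedIn : Subset n → Set
  LocallyConnectedIn S = ∀ v → v ∈ S → ConnectedIn (NbhdIn S v)

  IsClique : Subset n → Set
  IsClique Q = ∀ u v → u ∈ Q → v ∈ Q → u ≢ v → Adj u v

  IsMaximalClique : Subset n → Set
  IsMaximalClique Q = IsClique Q × (∀ T → IsClique T → Q ⊆ T → T ⊆ Q)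

  -- vertices of the clique graph K(G): maximal cliques.  The proof of
  -- maximality is irrelevant, so a vertex of K(G) is determined by its set.
  record KVertex : Set where
    constructor kv
    field
      clique : Subset n
      .isMax : IsMaximalClique clique

  KAdj : KVertex → KVertex → Set
  KAdj Q Q' = ∃ λ v → v ∈ KVertex.clique Q × v ∈ KVertex.clique Q'

CycSucc : ∀ {k} → Fin k → Fin k → Set
CycSucc {k} i j = (suc (toℕ i) ≡ toℕ j) ⊎ ((suc (toℕ i) ≡ k) × (toℕ j ≡ 0))

CycAdj : ∀ {k} → Fin k → Fin k → Set
CycAdj i j = CycSucc i j ⊎ CycSucc j i

IsInducedCycle : {V : Set} → (V → V → Set) → (k : ℕ) → (Fin k → V) → Set
IsInducedCycle R k c =
  Injective _≡_ _≡_ c ×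
  (∀ i j → i ≢ j → (R (c i) (c j) → CycAdj i j) × (CycAdj i j → R (c i) (c j)))

Chordal : {V : Set} → (V → V → Set) → Set
Chordal R = ∀ k → 4 ≤ k → ∀ c → ¬ IsInducedCycle R k c

CliqueChordal : Graph → Set
CliqueChordal G = Chordal (KAdj G)

-- Let v lie in the block B and let a, b be neighbours of v in B.  As B − v
-- is connected, a and b are joined by a path in B − v, and we show by
-- induction on its length that they are joined inside N_B(v).  If an inner
-- vertex of the path is adjacent to v, split the path there; if two vertices
-- at distance at least two along it are equal or adjacent, shortcut it.
-- Otherwise v together with the path is an induced cycle of length at least
-- four.  Maximal cliques on its edges form a cycle in K(G), and in the
-- chordal graph K(G) a cycle without chords between cliques two steps apart
-- cannot exist, so some vertex w lies in two such cliques.  Then w is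
-- adjacent to two far-apart vertices of the cycle, hence in B by maximality
-- of the block, and either joins a to b through N_B(v) directly or yields a
-- shorter path.

module Submission where

open import Defs

open import Data.Nat using (ℕ; zero; suc; _+_; _∸_; _≤_; _<_; z≤n; s≤s; _≟_; _≤?_)
open import Data.Nat.Properties
open import Data.Nat.Induction using (<-rec)
open import Data.Fin using (Fin; toℕ; suc)
open import Data.Fin.Properties using (toℕ-injective; toℕ≤pred[n]; all?; any?) renaming (_≟_ to _≟ᶠ_)
open import Data.Product using (_×_; _,_; ∃; proj₁; proj₂)
open import Data.Fin.Subset using (Subset; _∈_; _⊆_; _∪_; _-_; ⁅_⁆)
open import Data.Fin.Subset.Properties using (x∈p∩q⁺; x∈p∩q⁻; x∈p∪q⁺; x∈p∪q⁻; x∈⁅x⁆; x∈⁅y⁆⇒x≡y; x∈p∧x≢y⇒x∈p-y; p─q⊆p; _∈?_)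
open import Data.Vec using (_∷_; tabulate) renaming (there to thereᵛ)
open import Data.Vec.Properties using (lookup∘tabulate; lookup⇒[]=; []=⇒lookup)
open import Data.Sum using (_⊎_; inj₁; inj₂)
import Data.Sum as Sum
open import Data.Empty using (⊥-elim)
open import Relation.Nullary using (¬_; ¬?; Dec; yes; no; contradiction)
open import Relation.Nullary.Decidable using (_×-dec_; _→-dec_; _⊎-dec_)
open import Data.Bool using (true) renaming (_≟_ to _≟ᵇ_)
open import Data.List using (List; []; _∷_; allFin)
open import Data.List.Relation.Unary.Any using (here; there)
open import Data.List.Membership.Propositional using () renaming (_∈_ to _∈ₗ_)
open import Data.List.Membership.Propositional.Properties using (∈-allFin)
open import Relation.Binary.Definitions using (tri<; tri≈; tri>)
open import Relation.Binary.PropositionalEquality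
open import Function using (_∘_)

module ChordalProperties {V : Set} (R : V → V → Set) (R-sym : ∀ {x y} → R x y → R y x) where

  induced-cycle : ∀ k (f : ℕ → V) →
    (∀ {i j} → i ≤ k → j ≤ k → f i ≡ f j → i ≡ j) →
    (∀ {i} → i < k → R (f i) (f (suc i))) →
    R (f 0) (f k) →
    (∀ {i j} → 2 + i ≤ j → j ≤ k → ¬ (i ≡ 0 × j ≡ k) → ¬ R (f i) (f j)) →
    IsInducedCycle R (suc k) (λ i → f (toℕ i))
  induced-cycle k f injective edge closing chordless =
    (λ {i} {j} e → toℕ-injective (injective (toℕ≤pred[n] i) (toℕ≤pred[n] j) e)) ,
    λ i j i≢j → chord⇒adjacent i j i≢j , adjacent⇒edge i j
    where
    ordered : (i j : Fin (suc k)) → toℕ i < toℕ j → R (f (toℕ i)) (f (toℕ j)) → CycAdj i j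
    ordered i j i<j r with suc (toℕ i) ≟ toℕ j | (toℕ i ≟ 0) ×-dec (toℕ j ≟ k)
    ... | yes 1+i≡j | _ = inj₁ (inj₁ 1+i≡j)
    ... | no _ | yes (i≡0 , j≡k) = inj₂ (inj₂ (cong suc j≡k , i≡0))
    ... | no 1+i≢j | no ¬ends = contradiction r (chordless (≤∧≢⇒< i<j 1+i≢j) (toℕ≤pred[n] j) ¬ends)
    chord⇒adjacent : (i j : Fin (suc k)) → i ≢ j → R (f (toℕ i)) (f (toℕ j)) → CycAdj i j
    chord⇒adjacent i j i≢j r with <-cmp (toℕ i) (toℕ j)
    ... | tri< i<j _ _ = ordered i j i<j r
    ... | tri≈ _ i≡j _ = contradiction (toℕ-injective i≡j) i≢j
    ... | tri> _ _ j<i with ordered j i j<i (R-sym r)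
    ...   | inj₁ s = inj₂ s
    ...   | inj₂ s = inj₁ s
    successor⇒edge : (i j : Fin (suc k)) → CycSucc i j → R (f (toℕ i)) (f (toℕ j))
    successor⇒edge i j (inj₁ 1+i≡j) =
      subst (λ t → R (f (toℕ i)) (f t)) 1+i≡j (edge (subst (_≤ k) (sym 1+i≡j) (toℕ≤pred[n] j)))
    successor⇒edge i j (inj₂ (1+i≡1+k , j≡0)) rewrite suc-injective 1+i≡1+k | j≡0 = R-sym closing
    adjacent⇒edge : (i j : Fin (suc k)) → CycAdj i j → R (f (toℕ i)) (f (toℕ j))
    adjacent⇒edge i j (inj₁ s) = successor⇒edge i j s
    adjacent⇒edge i j (inj₂ s) = R-sym (successor⇒edge j i s)

  module _ (chordal : Chordal R) {k : ℕ} {f : ℕ → V}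
           (injective : ∀ {i j} → i ≤ k → j ≤ k → f i ≡ f j → i ≡ j)
           (edge : ∀ {i} → i < k → R (f i) (f (suc i)))
           (earless : ∀ {p} → 2 + p ≤ k → ¬ R (f p) (f (2 + p))) where

    ChordlessOfSpan : ℕ → Set
    ChordlessOfSpan d = 2 ≤ d → ∀ {p} → d + p ≤ k → ¬ R (f p) (f (d + p))

    -- A shortest chord would close an induced cycle of length at least four.
    earless⇒chordless : ∀ d → ChordlessOfSpan d
    earless⇒chordless = <-rec ChordlessOfSpan chordless-of-span
      where
      chordless-of-span : ∀ d → (∀ {d′} → d′ < d → ChordlessOfSpan d′) → ChordlessOfSpan d
      chordless-of-span (suc zero) _ (s≤s ())
      chordless-of-span (suc (suc zero)) _ _ = earless
      chordless-of-span (suc (suc (suc e))) shorter _ {p} d+p≤k r =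
        chordal (suc d) (s≤s (s≤s (s≤s (s≤s z≤n)))) _
          (induced-cycle d (λ t → f (t + p)) injective′ edge′ r chordless′)
        where
        d : ℕ
        d = 3 + e
        inside : ∀ {i} → i ≤ d → i + p ≤ k
        inside i≤d = ≤-trans (+-monoˡ-≤ p i≤d) d+p≤k
        injective′ : ∀ {i j} → i ≤ d → j ≤ d → f (i + p) ≡ f (j + p) → i ≡ j
        injective′ {i} {j} i≤d j≤d e = +-cancelʳ-≡ p i j (injective (inside i≤d) (inside j≤d) e)
        edge′ : ∀ {i} → i < d → R (f (i + p)) (f (suc i + p))
        edge′ i<d = edge (inside i<d)
        span< : ∀ s i → s + i ≤ d → ¬ (i ≡ 0 × s + i ≡ d) → s < d
        span< s zero s≤d ¬ends =
          ≤∧≢⇒< (subst (_≤ d) (+-identityʳ s) s≤d) (λ s≡d → ¬ends (refl , trans (+-identityʳ s) s≡d))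
        span< s (suc i) s+i≤d _ = <-≤-trans (m<m+n s (s≤s z≤n)) s+i≤d
        chordless′ : ∀ {i j} → 2 + i ≤ j → j ≤ d → ¬ (i ≡ 0 × j ≡ d) → ¬ R (f (i + p)) (f (j + p))
        chordless′ {i} {j} 2+i≤j j≤d ¬ends with j ∸ i | m∸n+n≡m (≤-trans (m≤n+m i 2) 2+i≤j)
        ... | s | refl =
          shorter (span< s i j≤d ¬ends) (+-cancelʳ-≤ i 2 s 2+i≤j) (subst (_≤ k) (+-assoc s i p) (inside j≤d))
          ∘ subst (λ t → R (f (i + p)) (f t)) (+-assoc s i p)

_◃_ : {A : Set} → A → (ℕ → A) → ℕ → A
(a ◃ x) zero = a
(a ◃ x) (suc k) = x k

join : {A : Set} → (ℕ → A) → ℕ → (ℕ → A) → ℕ → A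
join x zero y = x 0 ◃ y
join x (suc i) y = x 0 ◃ join (x ∘ suc) i y

join-head : {A : Set} (x : ℕ → A) (i : ℕ) (y : ℕ → A) → join x i y 0 ≡ x 0
join-head x zero y = refl
join-head x (suc i) y = refl

join-tail : {A : Set} (x : ℕ → A) (i : ℕ) (y : ℕ → A) (t : ℕ) → join x i y (suc i + t) ≡ y t
join-tail x zero y t = refl
join-tail x (suc i) y t = join-tail (x ∘ suc) i y t

module GraphProperties (G : Graph) where
  open Graph G using (n; adj; irref)

  adj-sym : ∀ {u w} → Adj G u w → Adj G w u
  adj-sym {u} {w} a = trans (Graph.sym G w u) a

  adj⇒≢ : ∀ {u w} → Adj G u w → u ≢ w
  adj⇒≢ {u} a refl with trans (sym a) (irref u)
  ... | ()

  ∈NbhdIn⁺ : ∀ {S v u} → u ∈ S → Adj G v u → u ∈ NbhdIn G S v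
  ∈NbhdIn⁺ {v = v} {u} u∈S a = x∈p∩q⁺ (u∈S , lookup⇒[]= u (tabulate (adj v)) (trans (lookup∘tabulate (adj v) u) a))

  ∈NbhdIn⁻ : ∀ {S v u} → u ∈ NbhdIn G S v → u ∈ S × Adj G v u
  ∈NbhdIn⁻ {S} {v} {u} u∈N with x∈p∩q⁻ S (tabulate (adj v)) u∈N
  ... | u∈S , u∈adj = u∈S , trans (sym (lookup∘tabulate (adj v) u)) ([]=⇒lookup u∈adj)

  ∈remove⁻ : ∀ {S x u} → u ∈ remove G S x → u ∈ S × u ≢ x
  ∈remove⁻ {S} {x} u∈S-x = p─q⊆p S ⁅ x ⁆ u∈S-x , λ { refl → x∉p-x S x u∈S-x }
    where
    x∉p-x : ∀ {n} (p : Subset n) x → ¬ (x ∈ p - x)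
    x∉p-x (_ ∷ p) (suc x) (thereᵛ x∈p-x) = x∉p-x p x x∈p-x

  -- Walks and paths

  walk-mono : ∀ {S T} → S ⊆ T → ∀ {u v} → WalkIn G S u v → WalkIn G T u v
  walk-mono S⊆T (stay u∈S) = stay (S⊆T u∈S)
  walk-mono S⊆T (step u∈S a w) = step (S⊆T u∈S) a (walk-mono S⊆T w)

  _++ʷ_ : ∀ {S u w v} → WalkIn G S u w → WalkIn G S w v → WalkIn G S u v
  stay _ ++ʷ w₂ = w₂
  step u∈S a w₁ ++ʷ w₂ = step u∈S a (w₁ ++ʷ w₂)

  edge-walk : ∀ {S u v} → u ∈ S → v ∈ S → Adj G u v → WalkIn G S u v
  edge-walk u∈S v∈S a = step u∈S a (stay v∈S)

  record IsPath (S : Subset n) (x : ℕ → Fin n) (m : ℕ) : Set where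
    field
      inside : ∀ {k} → k ≤ m → x k ∈ S
      edge   : ∀ {k} → k < m → Adj G (x k) (x (suc k))
  open IsPath public

  prefix : ∀ {S x m i} → IsPath S x m → i ≤ m → IsPath S x i
  prefix P i≤m = record
    { inside = λ k≤i → inside P (≤-trans k≤i i≤m)
    ; edge   = λ k<i → edge P (≤-trans k<i i≤m)
    }

  suffix : ∀ {S x m j} → IsPath S x m → j ≤ m → IsPath S (λ t → x (t + j)) (m ∸ j)
  suffix {m = m} {j} P j≤m = record
    { inside = λ k≤m∸j → inside P (shifted k≤m∸j)
    ; edge   = λ k<m∸j → edge P (shifted k<m∸j)
    }
    where
    shifted : ∀ {k} → k ≤ m ∸ j → k + j ≤ m
    shifted k≤m∸j = subst (_ ≤_) (m∸n+n≡m j≤m) (+-monoˡ-≤ j k≤m∸j)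

  tail : ∀ {S x m} → IsPath S x (suc m) → IsPath S (x ∘ suc) m
  tail P = record { inside = λ k≤m → inside P (s≤s k≤m) ; edge = λ k<m → edge P (s≤s k<m) }

  cons : ∀ {S x m u} → u ∈ S → Adj G u (x 0) → IsPath S x m → IsPath S (u ◃ x) (suc m)
  cons {S} {x} {m} {u} u∈S a P = record { inside = inside′ ; edge = edge′ }
    where
    inside′ : ∀ {k} → k ≤ suc m → (u ◃ x) k ∈ S
    inside′ {zero} _ = u∈S
    inside′ {suc k} (s≤s k≤m) = inside P k≤m
    edge′ : ∀ {k} → k < suc m → Adj G ((u ◃ x) k) ((u ◃ x) (suc k))
    edge′ {zero} _ = a
    edge′ {suc k} (s≤s k<m) = edge P k<m

  join-path : ∀ {S x y} i {r} → IsPath S x i → IsPath S y r → Adj G (x i) (y 0) →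
    IsPath S (join x i y) (suc i + r)
  join-path zero P Q a = cons (inside P z≤n) a Q
  join-path {x = x} {y} (suc i) P Q a =
    cons (inside P z≤n) (subst (Adj G (x 0)) (sym (join-head (x ∘ suc) i y)) (edge P (s≤s z≤n)))
         (join-path i (tail P) Q a)

  walk⇒path : ∀ {S u v} → WalkIn G S u v →
    ∃ λ m → ∃ λ x → IsPath S x m × x 0 ≡ u × x m ≡ v
  walk⇒path {u = u} (stay u∈S) = 0 , (λ _ → u) , record { inside = λ _ → u∈S ; edge = λ () } , refl , refl
  walk⇒path {u = u} (step u∈S a w) with walk⇒path w
  ... | m , x , P , refl , suffix-end = suc m , u ◃ x , cons u∈S a P , refl , suffix-end

  -- Blocks

  connected-extend : ∀ {S T w y} → ConnectedIn G S → S ⊆ T → w ∈ T → y ∈ S → Adj G w y →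
    (∀ {u} → u ∈ T → u ∈ S ⊎ u ≡ w) → ConnectedIn G T
  connected-extend {w = w} {y} S-conn S⊆T w∈T y∈S a T⊆S+w u v u∈T v∈T
    with T⊆S+w u∈T | T⊆S+w v∈T
  ... | inj₁ u∈S | inj₁ v∈S = walk-mono S⊆T (S-conn u v u∈S v∈S)
  ... | inj₂ refl | inj₁ v∈S = step w∈T a (walk-mono S⊆T (S-conn y v y∈S v∈S))
  ... | inj₁ u∈S | inj₂ refl = walk-mono S⊆T (S-conn u y u∈S y∈S) ++ʷ edge-walk (S⊆T y∈S) w∈T (adj-sym a)
  ... | inj₂ refl | inj₂ refl = stay w∈T

  module _ {B : Subset n} (block : IsBlock G B) where
    private
      B-connected : ConnectedIn G B
      B-connected = proj₁ (proj₁ block)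

    -- B ∪ ⁅ w ⁆ is again biconnected, so maximality of B puts w into B.
    adjacent-to-two⇒∈block : ∀ {w y₁ y₂} → y₁ ∈ B → y₂ ∈ B → y₁ ≢ y₂ →
      Adj G w y₁ → Adj G w y₂ → w ∈ B
    adjacent-to-two⇒∈block {w} {y₁} {y₂} y₁∈B y₂∈B y₁≢y₂ a₁ a₂ with w ∈? B
    ... | yes w∈B = w∈B
    ... | no w∉B = proj₂ block T B⊆T (T-connected , T-minus-connected) w∈T
      where
      T = B ∪ ⁅ w ⁆
      B⊆T : B ⊆ T
      B⊆T u∈B = x∈p∪q⁺ (inj₁ u∈B)
      w∈T : w ∈ T
      w∈T = x∈p∪q⁺ (inj₂ (x∈⁅x⁆ w))
      ∈T⁻ : ∀ {u} → u ∈ T → u ∈ B ⊎ u ≡ w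
      ∈T⁻ u∈T = Sum.map₂ (x∈⁅y⁆⇒x≡y w) (x∈p∪q⁻ B ⁅ w ⁆ u∈T)
      ∈T∧≢⇒∈B : ∀ {u} → u ∈ T → u ≢ w → u ∈ B
      ∈T∧≢⇒∈B u∈T u≢w with ∈T⁻ u∈T
      ... | inj₁ u∈B = u∈B
      ... | inj₂ u≡w = contradiction u≡w u≢w
      T-connected : ConnectedIn G T
      T-connected = connected-extend B-connected B⊆T w∈T y₁∈B a₁ ∈T⁻
      neighbour-avoiding : ∀ x → ∃ λ y → y ∈ B × y ≢ x × Adj G w y
      neighbour-avoiding x with y₁ ≟ᶠ x
      ... | yes refl = y₂ , y₂∈B , y₁≢y₂ ∘ sym , a₂
      ... | no y₁≢x = y₁ , y₁∈B , y₁≢x , a₁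
      T-minus-connected : ∀ x → x ∈ T → ConnectedIn G (remove G T x)
      T-minus-connected x x∈T with x ≟ᶠ w
      ... | yes refl = λ u v u∈T-w v∈T-w →
        walk-mono B⊆T-w (B-connected u v (∈B u∈T-w) (∈B v∈T-w))
        where
        B⊆T-w : B ⊆ remove G T w
        B⊆T-w {u} u∈B = x∈p∧x≢y⇒x∈p-y (B⊆T u∈B) λ { refl → w∉B u∈B }
        ∈B : ∀ {u} → u ∈ remove G T w → u ∈ B
        ∈B u∈T-w = let u∈T , u≢w = ∈remove⁻ u∈T-w in ∈T∧≢⇒∈B u∈T u≢w
      ... | no x≢w with neighbour-avoiding x
      ... | y , y∈B , y≢x , a =
        connected-extend (proj₂ (proj₁ block) x (∈T∧≢⇒∈B x∈T x≢w)) B-x⊆T-x (x∈p∧x≢y⇒x∈p-y w∈T (x≢w ∘ sym))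
          (x∈p∧x≢y⇒x∈p-y y∈B y≢x) a ∈T-x⁻
        where
        B-x⊆T-x : remove G B x ⊆ remove G T x
        B-x⊆T-x u∈B-x = let u∈B , u≢x = ∈remove⁻ u∈B-x in x∈p∧x≢y⇒x∈p-y (B⊆T u∈B) u≢x
        ∈T-x⁻ : ∀ {u} → u ∈ remove G T x → u ∈ remove G B x ⊎ u ≡ w
        ∈T-x⁻ u∈T-x with ∈remove⁻ u∈T-x
        ... | u∈T , u≢x = Sum.map₁ (λ u∈B → x∈p∧x≢y⇒x∈p-y u∈B u≢x) (∈T⁻ u∈T)

  -- Maximal cliques

  _AdjacentToAll_ : Fin n → Subset n → Set
  t AdjacentToAll Q = ∀ s → s ∈ Q → s ≢ t → Adj G t s

  adjacentToAll? : ∀ t Q → Dec (t AdjacentToAll Q)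
  adjacentToAll? t Q = all? λ s → (s ∈? Q) →-dec (¬? (s ≟ᶠ t) →-dec (adj t s ≟ᵇ true))

  adjacentToAll-anti : ∀ {t Q Q′} → Q ⊆ Q′ → t AdjacentToAll Q′ → t AdjacentToAll Q
  adjacentToAll-anti Q⊆Q′ t~Q′ s s∈Q = t~Q′ s (Q⊆Q′ s∈Q)

  insert : Fin n → Subset n → Subset n
  insert t Q with adjacentToAll? t Q
  ... | yes _ = Q ∪ ⁅ t ⁆
  ... | no _ = Q

  insert-⊇ : ∀ t Q → Q ⊆ insert t Q
  insert-⊇ t Q s∈Q with adjacentToAll? t Q
  ... | yes _ = x∈p∪q⁺ (inj₁ s∈Q)
  ... | no _ = s∈Q

  insert-∋ : ∀ {t Q} → t AdjacentToAll Q → t ∈ insert t Q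
  insert-∋ {t} {Q} t~Q with adjacentToAll? t Q
  ... | yes _ = x∈p∪q⁺ (inj₂ (x∈⁅x⁆ t))
  ... | no ¬t~Q = contradiction t~Q ¬t~Q

  insert-clique : ∀ t Q → IsClique G Q → IsClique G (insert t Q)
  insert-clique t Q Q-clique with adjacentToAll? t Q
  ... | no _ = Q-clique
  ... | yes t~Q = clique
    where
    clique : IsClique G (Q ∪ ⁅ t ⁆)
    clique s s′ s∈ s′∈ s≢s′ with x∈p∪q⁻ Q ⁅ t ⁆ s∈ | x∈p∪q⁻ Q ⁅ t ⁆ s′∈
    ... | inj₁ s∈Q | inj₁ s′∈Q = Q-clique s s′ s∈Q s′∈Q s≢s′
    ... | inj₁ s∈Q | inj₂ s′∈t rewrite x∈⁅y⁆⇒x≡y t s′∈t = adj-sym (t~Q s s∈Q s≢s′)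
    ... | inj₂ s∈t | inj₁ s′∈Q rewrite x∈⁅y⁆⇒x≡y t s∈t = t~Q s′ s′∈Q (s≢s′ ∘ sym)
    ... | inj₂ s∈t | inj₂ s′∈t = contradiction (trans (x∈⁅y⁆⇒x≡y t s∈t) (sym (x∈⁅y⁆⇒x≡y t s′∈t))) s≢s′

  greedy : List (Fin n) → Subset n → Subset n
  greedy [] Q = Q
  greedy (t ∷ ts) Q = greedy ts (insert t Q)

  greedy-⊇ : ∀ ts Q → Q ⊆ greedy ts Q
  greedy-⊇ [] Q s∈Q = s∈Q
  greedy-⊇ (t ∷ ts) Q s∈Q = greedy-⊇ ts (insert t Q) (insert-⊇ t Q s∈Q)

  greedy-clique : ∀ ts Q → IsClique G Q → IsClique G (greedy ts Q)
  greedy-clique [] Q Q-clique = Q-clique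
  greedy-clique (t ∷ ts) Q Q-clique = greedy-clique ts (insert t Q) (insert-clique t Q Q-clique)

  greedy-absorbs : ∀ {t} ts Q → t ∈ₗ ts → t AdjacentToAll greedy ts Q → t ∈ greedy ts Q
  greedy-absorbs (t ∷ ts) Q (here refl) t~M =
    greedy-⊇ ts (insert t Q) (insert-∋ (adjacentToAll-anti (greedy-⊇ ts (insert t Q) ∘ insert-⊇ t Q) t~M))
  greedy-absorbs (_ ∷ ts) Q (there t∈ts) t~M = greedy-absorbs ts _ t∈ts t~M

  cliqueThrough : Fin n → Fin n → Subset n
  cliqueThrough u w = greedy (w ∷ allFin n) ⁅ u ⁆

  cliqueThrough-maximal : ∀ u w → IsMaximalClique G (cliqueThrough u w)
  cliqueThrough-maximal u w = greedy-clique (w ∷ allFin n) ⁅ u ⁆ singleton-clique , maximal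
    where
    singleton-clique : IsClique G ⁅ u ⁆
    singleton-clique s s′ s∈ s′∈ s≢s′ = contradiction (trans (x∈⁅y⁆⇒x≡y u s∈) (sym (x∈⁅y⁆⇒x≡y u s′∈))) s≢s′
    maximal : ∀ T → IsClique G T → cliqueThrough u w ⊆ T → T ⊆ cliqueThrough u w
    maximal T T-clique M⊆T {t} t∈T =
      greedy-absorbs (w ∷ allFin n) ⁅ u ⁆ (there (∈-allFin t))
        λ s s∈M s≢t → T-clique t s t∈T (M⊆T s∈M) (s≢t ∘ sym)

  cliqueThrough-∋ˡ : ∀ u w → u ∈ cliqueThrough u w
  cliqueThrough-∋ˡ u w = greedy-⊇ (w ∷ allFin n) ⁅ u ⁆ (x∈⁅x⁆ u)

  cliqueThrough-∋ʳ : ∀ {u w} → Adj G u w → w ∈ cliqueThrough u w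
  cliqueThrough-∋ʳ {u} {w} a =
    greedy-⊇ (allFin n) (insert w ⁅ u ⁆) (insert-∋ λ s s∈u _ → subst (Adj G w) (sym (x∈⁅y⁆⇒x≡y u s∈u)) (adj-sym a))

  -- Edge cliques of a cycle

  Near : Fin n → Fin n → Set
  Near u w = u ≡ w ⊎ Adj G u w

  near∧≢⇒adj : ∀ {u w} → Near u w → u ≢ w → Adj G u w
  near∧≢⇒adj (inj₁ u≡w) u≢w = contradiction u≡w u≢w
  near∧≢⇒adj (inj₂ a) _ = a

  near? : ∀ u w → Dec (Near u w)
  near? u w = (u ≟ᶠ w) ⊎-dec (adj u w ≟ᵇ true)

  clique⇒near : ∀ {Q u w} → IsClique G Q → u ∈ Q → w ∈ Q → Near u w
  clique⇒near {u = u} {w} Q-clique u∈Q w∈Q with u ≟ᶠ w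
  ... | yes u≡w = inj₁ u≡w
  ... | no u≢w = inj₂ (Q-clique u w u∈Q w∈Q u≢w)

  NearOnlyAlongCycle : ℕ → (ℕ → Fin n) → Set
  NearOnlyAlongCycle k c = ∀ {i j} → i < j → j ≤ k → Near (c i) (c j) → j ≡ suc i ⊎ (i ≡ 0 × j ≡ k)

  -- Q 0 is a clique on the closing edge c k c 0 and Q (suc i) one on the
  -- edge c i c (suc i) of the cycle c 0, …, c k.
  record EdgeCliques (k : ℕ) (c : ℕ → Fin n) (Q : ℕ → Subset n) : Set where
    field
      clique    : ∀ i → IsClique G (Q i)
      last∈Q₀   : c k ∈ Q 0
      first∈Q₀  : c 0 ∈ Q 0
      start∈Q   : ∀ {i} → i < k → c i ∈ Q (suc i)
      end∈Q     : ∀ {i} → i < k → c (suc i) ∈ Q (suc i)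

    consecutive-meet : ∀ {i} → i < k → ∃ λ w → w ∈ Q i × w ∈ Q (suc i)
    consecutive-meet {zero} 0<k = c 0 , first∈Q₀ , start∈Q 0<k
    consecutive-meet {suc i} 1+i<k = c (suc i) , end∈Q (<-trans (n<1+n i) 1+i<k) , start∈Q 1+i<k

    closing-meet : ∀ {k′} → k ≡ suc k′ → ∃ λ w → w ∈ Q 0 × w ∈ Q k
    closing-meet refl = c k , last∈Q₀ , end∈Q ≤-refl

    module _ (3≤k : 3 ≤ k) (chordless : NearOnlyAlongCycle k c) where
      private
        near-in : ∀ {i u w} → u ∈ Q i → w ∈ Q i → Near u w
        near-in {i} = clique⇒near (clique i)
        k≢2 : k ≢ 2
        k≢2 k≡2 = <-irrefl refl (subst (3 ≤_) k≡2 3≤k)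

      distinct : ∀ {i j} → i < j → j ≤ k → Q i ≢ Q j
      distinct {zero} {suc zero} _ _ Q₀≡Q₁
        with chordless 1<k ≤-refl (near-in {0} (subst (c 1 ∈_) (sym Q₀≡Q₁) (end∈Q 0<k)) last∈Q₀)
        where
        1<k : 1 < k
        1<k = ≤-trans (s≤s (s≤s z≤n)) 3≤k
        0<k : 0 < k
        0<k = <-trans (s≤s z≤n) 1<k
      ... | inj₁ k≡2 = k≢2 k≡2
      distinct {zero} {suc (suc j)} _ 2+j≤k Q₀≡Q
        with chordless (s≤s z≤n) 2+j≤k (near-in {0} first∈Q₀ (subst (_ ∈_) (sym Q₀≡Q) (end∈Q 2+j≤k)))
      ... | inj₂ (_ , 2+j≡k) with chordless (s≤s z≤n) (<⇒≤ 2+j≤k)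
                                    (near-in {0} first∈Q₀ (subst (_ ∈_) (sym Q₀≡Q) (start∈Q 2+j≤k)))
      ...   | inj₁ refl = k≢2 (sym 2+j≡k)
      ...   | inj₂ (_ , 1+j≡k) = <-irrefl 1+j≡k (subst (suc j <_) 2+j≡k ≤-refl)
      distinct {suc i} {suc j} (s≤s i<j) 1+j≤k Q≡Q′
        with chordless (<-trans i<j (n<1+n j)) 1+j≤k
               (near-in {suc j} (subst (_ ∈_) Q≡Q′ (start∈Q (<-trans i<j 1+j≤k))) (end∈Q 1+j≤k))
      ... | inj₁ 1+j≡1+i = <-irrefl (sym (suc-injective 1+j≡1+i)) i<j
      ... | inj₂ (refl , 1+j≡k)
        with chordless i<j (<⇒≤ 1+j≤k) (near-in {suc j} (subst (_ ∈_) Q≡Q′ (start∈Q (<-trans i<j 1+j≤k))) (start∈Q 1+j≤k))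
      ...   | inj₁ refl = k≢2 (sym 1+j≡k)
      ...   | inj₂ (_ , j≡k) = <-irrefl j≡k 1+j≤k

      injective : ∀ {i j} → i ≤ k → j ≤ k → Q i ≡ Q j → i ≡ j
      injective {i} {j} i≤k j≤k Qi≡Qj with <-cmp i j
      ... | tri< i<j _ _ = contradiction Qi≡Qj (distinct i<j j≤k)
      ... | tri≈ _ i≡j _ = i≡j
      ... | tri> _ _ j<i = contradiction (sym Qi≡Qj) (distinct j<i i≤k)

shortcut-length : ∀ {i j m} → i < j → j ≤ m → i + (m ∸ j) < m
shortcut-length {i} {j} {m} i<j j≤m = subst (i + (m ∸ j) <_) (m+[n∸m]≡n j≤m) (+-monoˡ-< (m ∸ j) i<j)

module LocalConnectivity (G : Graph) (chordal : CliqueChordal G)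
                         {B : Subset (Graph.n G)} (block : IsBlock G B)
                         {v : Fin (Graph.n G)} (v∈B : v ∈ B) where
  open Graph G using (n; adj)
  open GraphProperties G
  open ChordalProperties (KAdj G) (λ (w , w∈Q , w∈Q′) → w , w∈Q′ , w∈Q)

  N : Subset n
  N = NbhdIn G B v

  S : Subset n
  S = remove G B v

  S∧adj⇒N : ∀ {u} → u ∈ S → Adj G v u → u ∈ N
  S∧adj⇒N u∈S a = ∈NbhdIn⁺ (proj₁ (∈remove⁻ u∈S)) a

  N⊆S : ∀ {u} → u ∈ N → u ∈ S
  N⊆S u∈N with ∈NbhdIn⁻ u∈N
  ... | u∈B , a = x∈p∧x≢y⇒x∈p-y u∈B (adj⇒≢ a ∘ sym)

  JoinedInN : ℕ → Set
  JoinedInN m = ∀ {x} → IsPath S x m → x 0 ∈ N → x m ∈ N → WalkIn G N (x 0) (x m)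

  module Reduction {m} (2≤m : 2 ≤ m) (shorter : ∀ {m′} → m′ < m → JoinedInN m′)
                   {x : ℕ → Fin n} (P : IsPath S x m) (x₀∈N : x 0 ∈ N) (xₘ∈N : x m ∈ N) where

    shorter-walk : ∀ {y m′ a b} → m′ < m → IsPath S y m′ → y 0 ≡ a → y m′ ≡ b → a ∈ N → b ∈ N →
      WalkIn G N a b
    shorter-walk m′<m Q refl refl a∈N b∈N = shorter m′<m Q a∈N b∈N

    suffix-end : ∀ {j} → j ≤ m → x ((m ∸ j) + j) ≡ x m
    suffix-end j≤m = cong x (m∸n+n≡m j≤m)

    through-neighbour : ∀ {i} → 0 < i → i < m → x i ∈ N → WalkIn G N (x 0) (x m)
    through-neighbour 0<i i<m xᵢ∈N =
      shorter i<m (prefix P (<⇒≤ i<m)) x₀∈N xᵢ∈N ++ʷ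
      shorter-walk (shortcut-length 0<i (<⇒≤ i<m)) (suffix P (<⇒≤ i<m)) refl (suffix-end (<⇒≤ i<m)) xᵢ∈N xₘ∈N

    shortcut : ∀ {i j} → 2 + i ≤ j → j ≤ m → Adj G (x i) (x j) → WalkIn G N (x 0) (x m)
    shortcut {i} {j} 2+i≤j j≤m a =
      shorter-walk (shortcut-length 2+i≤j j≤m)
        (join-path i (prefix P (≤-trans (m≤n+m i 2) (≤-trans 2+i≤j j≤m))) (suffix P j≤m) a)
        (join-head x i _) (trans (join-tail x i _ (m ∸ j)) (suffix-end j≤m)) x₀∈N xₘ∈N

    shortcut-near : ∀ {i j} → 2 + i ≤ j → j ≤ m → Near (x i) (x j) → WalkIn G N (x 0) (x m)
    shortcut-near 2+i≤j j≤m (inj₂ a) = shortcut 2+i≤j j≤m a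
    shortcut-near {i} {j} 2+i≤j j≤m (inj₁ xᵢ≡xⱼ) with m≤n⇒m<n∨m≡n j≤m
    ... | inj₁ j<m = shortcut (m≤n⇒m≤1+n 2+i≤j) j<m (subst (λ u → Adj G u (x (suc j))) (sym xᵢ≡xⱼ) (edge P j<m))
    ... | inj₂ refl = shorter-walk (<-≤-trans (m<n⇒m<1+n ≤-refl) 2+i≤j) (prefix P (≤-trans (m≤n+m i 2) 2+i≤j))
                        refl xᵢ≡xⱼ x₀∈N xₘ∈N

    module Cycle (no-interior : ∀ {i} → 0 < i → i < m → ¬ Adj G v (x i))
                 (no-shortcut : ∀ {i j} → 2 + i ≤ j → j ≤ m → ¬ Near (x i) (x j)) where

      c : ℕ → Fin n
      c = v ◃ x

      Q : ℕ → Subset n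
      Q = cliqueThrough (x m) v ◃ λ i → cliqueThrough (c i) (c (suc i))

      Q-maximal : ∀ i → IsMaximalClique G (Q i)
      Q-maximal zero = cliqueThrough-maximal (x m) v
      Q-maximal (suc i) = cliqueThrough-maximal (c i) (c (suc i))

      Qᴷ : ℕ → KVertex G
      Qᴷ i = kv (Q i) (Q-maximal i)

      x≢v : ∀ {k} → k ≤ m → x k ≢ v
      x≢v k≤m = proj₂ (∈remove⁻ (inside P k≤m))

      cycle-edge : ∀ {i} → i < suc m → Adj G (c i) (c (suc i))
      cycle-edge {zero} _ = proj₂ (∈NbhdIn⁻ x₀∈N)
      cycle-edge {suc i} (s≤s i<m) = edge P i<m

      edge-cliques : EdgeCliques (suc m) c Q
      edge-cliques = record
        { clique   = λ i → proj₁ (Q-maximal i)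
        ; last∈Q₀  = cliqueThrough-∋ˡ (x m) v
        ; first∈Q₀ = cliqueThrough-∋ʳ (adj-sym (proj₂ (∈NbhdIn⁻ xₘ∈N)))
        ; start∈Q  = λ {i} _ → cliqueThrough-∋ˡ (c i) (c (suc i))
        ; end∈Q    = λ i<k → cliqueThrough-∋ʳ (cycle-edge i<k)
        }
      open EdgeCliques edge-cliques

      near-only-along : NearOnlyAlongCycle (suc m) c
      near-only-along {zero} {suc j} _ (s≤s j≤m) (inj₁ v≡xⱼ) = contradiction (sym v≡xⱼ) (x≢v j≤m)
      near-only-along {zero} {suc j} _ (s≤s j≤m) (inj₂ a) with j ≟ 0 | m≤n⇒m<n∨m≡n j≤m
      ... | yes refl | _ = inj₁ refl
      ... | no _ | inj₂ refl = inj₂ (refl , refl)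
      ... | no j≢0 | inj₁ j<m = contradiction a (no-interior (n≢0⇒n>0 j≢0) j<m)
      near-only-along {suc i} {suc j} (s≤s i<j) (s≤s j≤m) near with j ≟ suc i
      ... | yes refl = inj₁ refl
      ... | no j≢1+i = contradiction near (no-shortcut (≤∧≢⇒< i<j (j≢1+i ∘ sym)) j≤m)

      3≤1+m : 3 ≤ suc m
      3≤1+m = s≤s 2≤m

      ¬earless : ¬ (∀ {p} → 2 + p ≤ suc m → ¬ KAdj G (Qᴷ p) (Qᴷ (2 + p)))
      ¬earless earless =
        earless⇒chordless chordal {f = Qᴷ}
          (λ i≤k j≤k Qᴷᵢ≡Qᴷⱼ → injective 3≤1+m near-only-along i≤k j≤k (cong KVertex.clique Qᴷᵢ≡Qᴷⱼ))
          consecutive-meet earless (suc m) (<⇒≤ 3≤1+m) (≤-reflexive (+-identityʳ (suc m)))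
          (subst (λ t → KAdj G (Qᴷ 0) (Qᴷ t)) (sym (+-identityʳ (suc m))) (closing-meet refl))

      ear : ∃ λ p → p < m × ∃ λ w → w ∈ Q p × w ∈ Q (2 + p)
      ear with anyUpTo? (λ p → any? λ w → (w ∈? Q p) ×-dec (w ∈? Q (2 + p))) m
      ... | yes found = found
      ... | no none = ⊥-elim (¬earless earless)
        where
        earless : ∀ {p} → 2 + p ≤ suc m → ¬ KAdj G (Qᴷ p) (Qᴷ (2 + p))
        earless (s≤s p<m) (w , w∈Qₚ , w∈Q₂₊ₚ) = none (_ , p<m , w , w∈Qₚ , w∈Q₂₊ₚ)

      near-in : ∀ i {u w} → u ∈ Q i → w ∈ Q i → Near u w
      near-in i = clique⇒near (clique i)

      near-both⇒adjacent∈B : ∀ {w i j} → 2 + i ≤ j → j ≤ m → Near w (x i) → Near w (x j) →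
        Adj G w (x i) × Adj G w (x j) × w ∈ B
      near-both⇒adjacent∈B {i = i} 2+i≤j j≤m near-i near-j with adjacent near-i near-j
        where
        adjacent : ∀ {w} → Near w (x i) → Near w (x _) → Adj G w (x i) × Adj G w (x _)
        adjacent (inj₁ refl) near = contradiction near (no-shortcut 2+i≤j j≤m)
        adjacent (inj₂ a) (inj₁ refl) = contradiction (inj₂ (adj-sym a)) (no-shortcut 2+i≤j j≤m)
        adjacent (inj₂ a) (inj₂ b) = a , b
      ... | aᵢ , aⱼ = aᵢ , aⱼ ,
        adjacent-to-two⇒∈block block (∈B (≤-trans (m≤n+m i 2) (≤-trans 2+i≤j j≤m))) (∈B j≤m)
          (no-shortcut 2+i≤j j≤m ∘ inj₁) aᵢ aⱼ
        where
        ∈B : ∀ {k} → k ≤ m → x k ∈ B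
        ∈B k≤m = proj₁ (∈remove⁻ (inside P k≤m))

      near-interior⇒≢v : ∀ {w i} → 0 < i → i < m → Near w (x i) → w ≢ v
      near-interior⇒≢v 0<i i<m (inj₁ refl) xᵢ≡v = x≢v (<⇒≤ i<m) xᵢ≡v
      near-interior⇒≢v 0<i i<m (inj₂ a) refl = no-interior 0<i i<m a

      -- A vertex w of Q p ∩ Q (2 + p) is near four consecutive vertices of the
      -- cycle v, x 0, …, x m: x m, v, x 0, x 1 for p = 0; v, x 0, x 1, x 2 for
      -- p = 1; and x q, …, x (3 + q) for p = 2 + q.
      ear-around-v : ∀ {w} → w ∈ Q 0 → w ∈ Q 2 → WalkIn G N (x 0) (x m)
      ear-around-v w∈Q₀ w∈Q₂
        with near-both⇒adjacent∈B {i = 0} 2≤m ≤-refl (near-in 2 w∈Q₂ (start∈Q 1<1+m)) (near-in 0 w∈Q₀ last∈Q₀)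
        where
        1<1+m : 1 < suc m
        1<1+m = s≤s (<⇒≤ 2≤m)
      ... | a₀ , aₘ , w∈B = step x₀∈N (adj-sym a₀) (edge-walk w∈N xₘ∈N aₘ)
        where
        w≢v : _ ≢ v
        w≢v = near-interior⇒≢v (s≤s z≤n) 2≤m (near-in 2 w∈Q₂ (end∈Q (s≤s (<⇒≤ 2≤m))))
        w∈N : _ ∈ N
        w∈N = ∈NbhdIn⁺ w∈B (adj-sym (near∧≢⇒adj (near-in 0 w∈Q₀ first∈Q₀) w≢v))

      ear-after-v : ∀ {w} → 1 < m → w ∈ Q 1 → w ∈ Q 3 → WalkIn G N (x 0) (x m)
      ear-after-v 1<m w∈Q₁ w∈Q₃
        with near-both⇒adjacent∈B {i = 0} ≤-refl 2≤m (near-in 1 w∈Q₁ (end∈Q (s≤s z≤n))) (near-in 3 w∈Q₃ (end∈Q (s≤s 2≤m)))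
      ... | a₀ , a₂ , w∈B =
        step x₀∈N (adj-sym a₀)
          (shorter-walk (shortcut-length {1} ≤-refl 2≤m) (cons w∈S a₂ (suffix P 2≤m)) refl (suffix-end 2≤m) w∈N xₘ∈N)
        where
        w≢v : _ ≢ v
        w≢v = near-interior⇒≢v (s≤s z≤n) 1<m (near-in 3 w∈Q₃ (start∈Q (s≤s 1<m)))
        w∈S : _ ∈ S
        w∈S = x∈p∧x≢y⇒x∈p-y w∈B w≢v
        w∈N : _ ∈ N
        w∈N = ∈NbhdIn⁺ w∈B (adj-sym (near∧≢⇒adj (near-in 1 w∈Q₁ (start∈Q (s≤s z≤n))) w≢v))

      ear-inside : ∀ {w} q → 3 + q ≤ m → w ∈ Q (2 + q) → w ∈ Q (4 + q) → WalkIn G N (x 0) (x m)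
      ear-inside {w} q 3+q≤m w∈Q₂₊q w∈Q₄₊q
        with near-both⇒adjacent∈B {i = q} (n≤1+n _) 3+q≤m
               (near-in (2 + q) w∈Q₂₊q (start∈Q (s≤s (≤-trans (m≤n+m (suc q) 2) 3+q≤m))))
               (near-in (4 + q) w∈Q₄₊q (end∈Q (s≤s 3+q≤m)))
      ... | aₚ , a₃₊q , w∈B =
        shorter-walk length
          (join-path q (prefix P (≤-trans (m≤n+m q 3) 3+q≤m)) (cons w∈S a₃₊q (suffix P 3+q≤m)) (adj-sym aₚ))
          (join-head x q _) (trans (join-tail x q _ (suc (m ∸ (3 + q)))) (suffix-end 3+q≤m)) x₀∈N xₘ∈N
        where
        1+q<m : suc q < m
        1+q<m = <-trans (n<1+n (suc q)) 3+q≤m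
        w∈S : w ∈ S
        w∈S = x∈p∧x≢y⇒x∈p-y w∈B (near-interior⇒≢v (s≤s z≤n) 1+q<m (near-in (2 + q) w∈Q₂₊q (end∈Q (s≤s (<⇒≤ 1+q<m)))))
        length : suc q + suc (m ∸ (3 + q)) < m
        length = subst (_< m) (sym (+-suc (suc q) (m ∸ (3 + q)))) (shortcut-length ≤-refl 3+q≤m)

      walk : WalkIn G N (x 0) (x m)
      walk with ear
      ... | zero , _ , _ , w∈Q₀ , w∈Q₂ = ear-around-v w∈Q₀ w∈Q₂
      ... | suc zero , 1<m , _ , w∈Q₁ , w∈Q₃ = ear-after-v 1<m w∈Q₁ w∈Q₃
      ... | suc (suc q) , 3+q≤m , _ , w∈Q₂₊q , w∈Q₄₊q = ear-inside q 3+q≤m w∈Q₂₊q w∈Q₄₊q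

    walk : WalkIn G N (x 0) (x m)
    walk with anyUpTo? (λ i → (1 ≤? i) ×-dec (adj v (x i) ≟ᵇ true)) m
    ... | yes (i , i<m , 0<i , a) = through-neighbour 0<i i<m (S∧adj⇒N (inside P (<⇒≤ i<m)) a)
    ... | no no-interior
      with anyUpTo? (λ j → anyUpTo? (λ i → (2 + i ≤? j) ×-dec near? (x i) (x j)) j) (suc m)
    ...   | yes (j , s≤s j≤m , i , _ , 2+i≤j , near) = shortcut-near 2+i≤j j≤m near
    ...   | no no-shortcut = Cycle.walk
            (λ 0<i i<m a → no-interior (_ , i<m , 0<i , a))
            (λ 2+i≤j j≤m near → no-shortcut (_ , s≤s j≤m , _ , <-trans (n<1+n _) 2+i≤j , 2+i≤j , near))

  walk-in-N : ∀ m → JoinedInN m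
  walk-in-N = <-rec JoinedInN from-shorter
    where
    from-shorter : ∀ m → (∀ {m′} → m′ < m → JoinedInN m′) → JoinedInN m
    from-shorter zero _ _ x₀∈N _ = stay x₀∈N
    from-shorter (suc zero) _ P x₀∈N x₁∈N = edge-walk x₀∈N x₁∈N (edge P (s≤s z≤n))
    from-shorter (suc (suc m)) shorter P x₀∈N xₘ∈N = Reduction.walk (s≤s (s≤s z≤n)) shorter P x₀∈N xₘ∈N

  N-connected : ConnectedIn G N
  N-connected a b a∈N b∈N with walk⇒path (proj₂ (proj₁ block) v v∈B a b (N⊆S a∈N) (N⊆S b∈N))
  ... | m , x , P , refl , refl = walk-in-N m P a∈N b∈N

lemma4 : (G : Graph) → Connected G → CliqueChordal G →
    (B : Subset (Graph.n G)) → IsBlock G B → LocallyConnectedIn G B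
lemma4 G _ chordal B block v v∈B = LocalConnectivity.N-connected G chordal block v∈B
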